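{- Let $\mathcal{A}=(Q,\delta,I,Q_F\cup\delta_F)$ be a Büchi automaton. Then $\mathcal{L}(\mathcal{A})=\mathcal{L}(\mathrm{Deelev}(\mathcal{A}))$, where $\mathrm{Deelev}(\mathcal{A})$ is the BA defined in the context.
   Context: A Büchi automaton (BA) over a finite alphabet $\Sigma$ is $\mathcal{A}=(Q,\delta,I,Q_F\cup\delta_F)$ with finite states $Q$, transition function $\delta\colon Q\times\Sigma\to2^Q$ (also viewed as a set of transitions $p\xrightarrow{a}q$ with $q\in\delta(p,a)$), initial states $I\subseteq Q$, accepting states $Q_F\subseteq Q$ and accepting transitions $\delta_F\subseteq\delta$. A run on $\alpha=\alpha_0\alpha_1\cdots$ from $q$ is $\rho$ with $\rho_0=q$, $\rho_{i+1}\in\delta(\rho_i,\alpha_i)$; accepting iff a state of $Q_F$ occurs infinitely often or a transition of $\delta_F$ is taken infinitely often; $\mathcal{L}(\mathcal{A})$ is the set of words with an accepting run from an initial state. An MSCC is a maximal set of mutually reachable states (every state belongs to exactly one MSCC); let $M$ be the set of MSCCs of $\mathcal{A}$. For each $q\in Q$ let $\bar q$ be a fresh copy, and for $X\subseteq Q$ let $\bar X=\{\bar q\mid q\in X\}$, with $\bar Q\cap Q=\emptyset$. $\mathrm{Deelev}(\mathcal{A})=(Q',\delta',I',Q'_F\cup\delta'_F)$ where $Q'=Q\cup\bar Q$; for $q\in Q$ and $a\in\Sigma$: $\delta'(q,a)=\delta(q,a)\cup\overline{\delta(q,a)}$ and $\delta'(\bar q,a)=\overline{\delta(q,a)\cap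 C}$ where $C\in M$ is the MSCC containing $q$; $I'=I$; $Q'_F=\overline{Q_F}$; $\delta'_F=\{\bar q\xrightarrow{a}\bar r\mid q\xrightarrow{a}r\in\delta_F\}\cap\delta'$. -}

module Defs where

open import Data.Nat using (ℕ; suc; _≤_)
open import Data.Fin using (Fin)
open import Data.Product using (Σ; ∃; ∃-syntax; _×_; _,_)
open import Data.Sum using (_⊎_; inj₁; inj₂)
open import Data.Empty using (⊥)
open import Relation.Binary.Construct.Closure.ReflexiveTransitive using (Star)

-- Subsets of Q are predicates Q → Set; the transition function
-- δ : Q × Σ → 2^Q is given as the relation δ p a q ("q ∈ δ(p,a)").
record BA (Q Σ' : Set) : Set₁ where
  field
    δ    : Q → Σ' → Q → Set
    I    : Q → Set
    QF   : Q → Set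
    δF   : Q → Σ' → Q → Set
    δF⊆δ : ∀ p a q → δF p a q → δ p a q

Word : Set → Set
Word Σ' = ℕ → Σ'

InfOften : (ℕ → Set) → Set
InfOften P = ∀ i → ∃[ j ] (i ≤ j × P j)

module _ {Q Σ' : Set} (A : BA Q Σ') where
  open BA A

  IsRun : Word Σ' → (ℕ → Q) → Set
  IsRun α ρ = ∀ i → δ (ρ i) (α i) (ρ (suc i))

  Accepting : Word Σ' → (ℕ → Q) → Set
  Accepting α ρ = InfOften (λ i → QF (ρ i))
                ⊎ InfOften (λ i → δF (ρ i) (α i) (ρ (suc i)))

  _∈L : Word Σ' → Set
  α ∈L = ∃[ ρ ] (I (ρ 0) × IsRun α ρ × Accepting α ρ)

  Step : Q → Q → Set
  Step p q = ∃[ a ] δ p a q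

  Reach : Q → Q → Set
  Reach = Star Step

  InMSCCOf : Q → Q → Set
  InMSCCOf q r = Reach q r × Reach r q

-- Deelev(A); states Q' = Q ⊎ Q', inj₁ q = q, inj₂ q = q̄
module _ {Q Σ' : Set} (A : BA Q Σ') where
  open BA A

  δ' : Q ⊎ Q → Σ' → Q ⊎ Q → Set
  δ' (inj₁ q) a (inj₁ r) = δ q a r
  δ' (inj₁ q) a (inj₂ r) = δ q a r
  δ' (inj₂ q) a (inj₁ r) = ⊥
  δ' (inj₂ q) a (inj₂ r) = δ q a r × InMSCCOf A q r

  I' : Q ⊎ Q → Set
  I' (inj₁ q) = I q
  I' (inj₂ q) = ⊥

  QF' : Q ⊎ Q → Set
  QF' (inj₁ q) = ⊥
  QF' (inj₂ q) = QF q

  δF' : Q ⊎ Q → Σ' → Q ⊎ Q → Set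
  δF' (inj₂ q) a (inj₂ r) = δF q a r × δ' (inj₂ q) a (inj₂ r)
  δF' _ _ _ = ⊥

  δF'⊆δ' : ∀ p a q → δF' p a q → δ' p a q
  δF'⊆δ' (inj₂ q) a (inj₂ r) (_ , t) = t
  δF'⊆δ' (inj₁ _) _ (inj₁ _) ()
  δF'⊆δ' (inj₁ _) _ (inj₂ _) ()
  δF'⊆δ' (inj₂ _) _ (inj₁ _) ()

  Deelev : BA (Q ⊎ Q) Σ'
  Deelev = record { δ = δ' ; I = I' ; QF = QF' ; δF = δF' ; δF⊆δ = δF'⊆δ' }

_∈ℒ_ : {Q Σ' : Set} → Word Σ' → BA Q Σ' → Set
α ∈ℒ A = _∈L A α

module Submission where

-- An accepting run of A over a finite state set visits some state q infinitely often, so from the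
-- first visit to q on, every state of the run can reach q and is reachable from q: the tail of the
-- run stays inside one MSCC.  Switching to the barred copy right after that point therefore yields
-- a run of Deelev(A) that keeps all the accepting states and transitions of the tail.  Conversely,
-- forgetting the bars maps every run of Deelev(A) to a run of A with the same acceptance.

open import Defs
open import Level using (0ℓ)
open import Data.Nat using (ℕ; zero; suc; _≤_; _<_; _⊔_; _≤?_; _≤′_; ≤′-refl; ≤′-step)
open import Data.Nat.Properties
  using (≤-refl; <⇒≤; <⇒≱; ≰⇒>; m≤n⇒m≤1+n; m⊔n≤o⇒m≤o; m⊔n≤o⇒n≤o; ≤⇒≤′)
open import Data.Fin using (Fin; zero; suc)
open import Data.Product using (_×_; _,_; ∃-syntax)
open import Data.Sum using (_⊎_; inj₁; inj₂; reduce)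
open import Data.Empty using (⊥-elim)
open import Function using (_∘_)
open import Relation.Nullary using (¬_; yes; no)
open import Relation.Binary.PropositionalEquality using (_≡_; refl; sym; trans; subst; subst₂)
open import Relation.Binary.Construct.Closure.ReflexiveTransitive using (ε; _◅_; _◅◅_)
open import Axiom.ExcludedMiddle using (ExcludedMiddle)
open import Axiom.DoubleNegationElimination using (em⇒dne)

Eventually : (ℕ → Set) → Set
Eventually P = ∃[ b ] (∀ j → b ≤ j → P j)

InfOften-mono : {P R : ℕ → Set} → Eventually (λ j → P j → R j) → InfOften P → InfOften R
InfOften-mono (b , P⇒R) inf i with inf (i ⊔ b)
... | j , i⊔b≤j , pj = j , m⊔n≤o⇒m≤o i b i⊔b≤j , P⇒R j (m⊔n≤o⇒n≤o i b i⊔b≤j) pj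

Eventually-∀Fin : ∀ {n} {P : Fin n → ℕ → Set} →
                  (∀ q → Eventually (P q)) → Eventually (λ j → ∀ q → P q j)
Eventually-∀Fin {zero} _ = 0 , λ _ _ ()
Eventually-∀Fin {suc n} ev with ev zero | Eventually-∀Fin (ev ∘ suc)
... | b , p | c , ps = b ⊔ c , λ where
  j b⊔c≤j zero    → p j (m⊔n≤o⇒m≤o b c b⊔c≤j)
  j b⊔c≤j (suc q) → ps j (m⊔n≤o⇒n≤o b c b⊔c≤j) q

module Classical (em : ExcludedMiddle 0ℓ) where

  ¬InfOften⇒Eventually¬ : {P : ℕ → Set} → ¬ InfOften P → Eventually (¬_ ∘ P)
  ¬InfOften⇒Eventually¬ ¬inf = em⇒dne em λ ¬ev →
    ¬inf λ i → em⇒dne em λ ¬later → ¬ev (i , λ j i≤j pj → ¬later (j , i≤j , pj))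

  infinite-pigeonhole : ∀ {n} (f : ℕ → Fin n) → ∃[ q ] InfOften (λ i → f i ≡ q)
  infinite-pigeonhole f = em⇒dne em λ none →
    let b , avoids = Eventually-∀Fin λ q → ¬InfOften⇒Eventually¬ λ inf → none (q , inf)
    in avoids b ≤-refl (f b) refl

module _ {Q Σ' : Set} {A : BA Q Σ'} {α : Word Σ'} where
  open BA A

  Reach-along-run : ∀ {ρ} → IsRun A α ρ → ∀ {i j} → i ≤′ j → Reach A (ρ i) (ρ j)
  Reach-along-run run ≤′-refl            = ε
  Reach-along-run run (≤′-step {j} i≤′j) = Reach-along-run run i≤′j ◅◅ ((α j , run j) ◅ ε)

  recurrent-run-stays-in-MSCC : ∀ {ρ q} → IsRun A α ρ → InfOften (λ i → ρ i ≡ q) →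
                                Eventually (λ i → InMSCCOf A (ρ i) (ρ (suc i)))
  recurrent-run-stays-in-MSCC {ρ} run inf with inf 0
  ... | N , _ , ρN≡q = N , λ i N≤i → ((α i , run i) ◅ ε) , (back-to-N i ◅◅ reach N≤i)
    where
    reach : ∀ {i j} → i ≤ j → Reach A (ρ i) (ρ j)
    reach = Reach-along-run run ∘ ≤⇒≤′

    back-to-N : ∀ i → Reach A (ρ (suc i)) (ρ N)
    back-to-N i with inf (suc i)
    ... | m , i<m , ρm≡q = subst (Reach A (ρ (suc i))) (trans ρm≡q (sym ρN≡q)) (reach i<m)

  switch : ℕ → (ℕ → Q) → ℕ → Q ⊎ Q
  switch N ρ i with i ≤? N
  ... | yes _ = inj₁ (ρ i)
  ... | no  _ = inj₂ (ρ i)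

  switch-late : ∀ {N ρ i} → N < i → switch N ρ i ≡ inj₂ (ρ i)
  switch-late {N} {ρ} {i} N<i with i ≤? N
  ... | yes i≤N = ⊥-elim (<⇒≱ N<i i≤N)
  ... | no  _   = refl

  switch-run : ∀ {N ρ} → IsRun A α ρ → (∀ i → N ≤ i → InMSCCOf A (ρ i) (ρ (suc i))) →
               IsRun (Deelev A) α (switch N ρ)
  switch-run {N} {ρ} run mscc i with i ≤? N | suc i ≤? N
  ... | yes _   | yes _    = run i
  ... | yes _   | no  _    = run i
  ... | no  i≰N | yes i<N  = ⊥-elim (i≰N (<⇒≤ i<N))
  ... | no  i≰N | no  _    = run i , mscc i (<⇒≤ (≰⇒> i≰N))

  switch-accepting : ∀ {N ρ} → IsRun A α ρ → (∀ i → N ≤ i → InMSCCOf A (ρ i) (ρ (suc i))) →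
                     Accepting A α ρ → Accepting (Deelev A) α (switch N ρ)
  switch-accepting {N} {ρ} run mscc (inj₁ infQF) = inj₁ (InfOften-mono (suc N , QF⇒QF') infQF)
    where
    QF⇒QF' : ∀ j → N < j → QF (ρ j) → QF' A (switch N ρ j)
    QF⇒QF' j N<j = subst (QF' A) (sym (switch-late N<j))
  switch-accepting {N} {ρ} run mscc (inj₂ infδF) = inj₂ (InfOften-mono (suc N , δF⇒δF') infδF)
    where
    δF⇒δF' : ∀ j → N < j → δF (ρ j) (α j) (ρ (suc j)) →
             δF' A (switch N ρ j) (α j) (switch N ρ (suc j))
    δF⇒δF' j N<j t = subst₂ (λ p r → δF' A p (α j) r)
                            (sym (switch-late N<j)) (sym (switch-late (m≤n⇒m≤1+n N<j)))
                            (t , run j , mscc j (<⇒≤ N<j))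

  recurrent-accepting-run⇒∈ℒDeelev : ∀ {ρ q} → I (ρ 0) → IsRun A α ρ → Accepting A α ρ →
                                     InfOften (λ i → ρ i ≡ q) → α ∈ℒ Deelev A
  recurrent-accepting-run⇒∈ℒDeelev {ρ} init run acc inf with recurrent-run-stays-in-MSCC run inf
  ... | N , mscc = switch N ρ , init , switch-run run mscc , switch-accepting run mscc acc

  δ'⇒δ : ∀ p a r → δ' A p a r → δ (reduce p) a (reduce r)
  δ'⇒δ (inj₁ _) _ (inj₁ _) t       = t
  δ'⇒δ (inj₁ _) _ (inj₂ _) t       = t
  δ'⇒δ (inj₂ _) _ (inj₂ _) (t , _) = t

  δF'⇒δF : ∀ p a r → δF' A p a r → δF (reduce p) a (reduce r)
  δF'⇒δF (inj₂ _) _ (inj₂ _) (t , _) = t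

  QF'⇒QF : ∀ p → QF' A p → QF (reduce p)
  QF'⇒QF (inj₂ _) x = x

  I'⇒I : ∀ p → I' A p → I (reduce p)
  I'⇒I (inj₁ _) x = x

  ∈ℒDeelev⇒∈ℒ : α ∈ℒ Deelev A → α ∈ℒ A
  ∈ℒDeelev⇒∈ℒ (ρ , init , run , acc) =
    reduce ∘ ρ , I'⇒I (ρ 0) init , (λ i → δ'⇒δ (ρ i) (α i) (ρ (suc i)) (run i)) , reduce-accepting acc
    where
    reduce-accepting : Accepting (Deelev A) α ρ → Accepting A α (reduce ∘ ρ)
    reduce-accepting (inj₁ inf) = inj₁ (InfOften-mono (0 , λ j _ → QF'⇒QF (ρ j)) inf)
    reduce-accepting (inj₂ inf) = inj₂ (InfOften-mono (0 , λ j _ → δF'⇒δF (ρ j) (α j) (ρ (suc j))) inf)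

lemma6 : ExcludedMiddle 0ℓ →
         (n k : ℕ) (A : BA (Fin n) (Fin k)) (α : Word (Fin k)) →
         (α ∈ℒ A → α ∈ℒ Deelev A) × (α ∈ℒ Deelev A → α ∈ℒ A)
lemma6 em n k A α = ∈ℒ⇒∈ℒDeelev , ∈ℒDeelev⇒∈ℒ
  where
  ∈ℒ⇒∈ℒDeelev : α ∈ℒ A → α ∈ℒ Deelev A
  ∈ℒ⇒∈ℒDeelev (ρ , init , run , acc) =
    let _ , inf = Classical.infinite-pigeonhole em ρ
    in recurrent-accepting-run⇒∈ℒDeelev init run acc inf
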